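{- Let $k$ be a prime power, and let $A_k$ be the graph constructed from a finite affine plane of order $k$ with an arbitrary strict linear order $<$ on its points, as described in the context. Then $A_k$ contains no triangles, $\alpha(A_k) \leq 2k^2 + k$, and $\chi(A_k) \geq \frac{k(k + 1)}{2k + 1}$.
   Context: A finite affine plane of order $k$ has $k^2$ points and $k^2+k$ lines, each line containing $k$ points, and any two distinct points lie on exactly one common line. The graph $A_k$: fix such a plane and any strict linear order $<$ on its points; the vertices are all incidence pairs $(p, L)$ with $p$ a point on line $L$; vertices $(p, L)$ and $(p', L')$ are adjacent iff $p < p'$, $L \neq L'$, and $p \in L'$. $\alpha$ is the independence number and $\chi$ the chromatic number. -}

module Defs where

open import Level using (0ℓ)
open import Data.Nat using (ℕ; suc; _+_; _*_; _^_)
open import Data.Nat.Primality using (Prime)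
open import Data.Fin using (Fin)
open import Data.Fin.Subset using (Subset; _∈_; ∣_∣)
open import Data.Product using (Σ; ∃; ∃-syntax; _×_; _,_)
open import Data.Sum using (_⊎_)
open import Data.List using (List)
open import Data.List.Relation.Unary.All using (All)
open import Data.List.Relation.Unary.AllPairs using (AllPairs)
open import Data.List.Relation.Unary.Unique.Propositional using (Unique)
open import Relation.Binary.PropositionalEquality using (_≡_; _≢_)
open import Relation.Binary.Core using (Rel)
open import Relation.Nullary using (¬_)

IsPrimePower : ℕ → Set
IsPrimePower k = ∃[ p ] ∃[ e ] (Prime p × k ≡ p ^ suc e)

Point : ℕ → Set
Point k = Fin (k * k)

Line : ℕ → Set
Line k = Fin (k * k + k)

record AffinePlane (k : ℕ) : Set where
  field
    line     : Line k → Subset (k * k)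
    lineSize : ∀ L → ∣ line L ∣ ≡ k
    unique-line : ∀ (p q : Point k) → p ≢ q →
      ∃[ L ] ((p ∈ line L × q ∈ line L) ×
              (∀ L′ → p ∈ line L′ → q ∈ line L′ → L′ ≡ L))

module Graph {k : ℕ} (P : AffinePlane k) (_≺_ : Rel (Point k) 0ℓ) where
  open AffinePlane P

  Pair : Set
  Pair = Point k × Line k

  IsVertex : Pair → Set
  IsVertex (p , L) = p ∈ line L

  Arc : Pair → Pair → Set
  Arc (p , L) (p′ , L′) = (p ≺ p′) × (L ≢ L′) × (p ∈ line L′)

  Adj : Pair → Pair → Set
  Adj u v = Arc u v ⊎ Arc v u

  TriangleFree : Set
  TriangleFree = ∀ u v w → IsVertex u → IsVertex v → IsVertex w →
    ¬ (Adj u v × Adj v w × Adj u w)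

  Independent : List Pair → Set
  Independent xs = Unique xs × All IsVertex xs × AllPairs (λ u v → ¬ Adj u v) xs

  IndependenceNumber≤ : ℕ → Set
  IndependenceNumber≤ n = ∀ xs → Independent xs → Data.List.length xs Data.Nat.≤ n

  ProperColouring : ℕ → Set
  ProperColouring m =
    Σ ((u : Pair) → IsVertex u → Fin m) λ c →
      ∀ u v (iu : IsVertex u) (iv : IsVertex v) → Adj u v → ¬ (c u iu ≡ c v iv)

{-# OPTIONS --safe #-}
-- In a transitively oriented triangle (p,L) → (q,M) → (r,N), (p,L) → (r,N), the points p ≺ q
-- both lie on M and on N although M ≠ N; a cyclically oriented one contradicts the acyclicity of ≺.
-- In an independent set I, send (p,L) to the line L if I also contains some (p,L′) with L′ ≠ L,
-- and to the point p otherwise. This is injective on I: if (p,L) and (q,L) are both sent to L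
-- and p ≺ q, then (p,L′) → (q,L) is an arc. Hence |I| ≤ k² + (k² + k). Finally A_k has
-- (k² + k)k vertices and every colour class is independent, so m(2k² + k) ≥ (k² + k)k.
module Submission where

open import Defs
open import Level using (0ℓ)
open import Data.Nat using (ℕ; zero; suc; _+_; _*_; _≤_; _<_; z≤n)
open import Data.Nat.Properties
  using (+-suc; +-mono-≤; ≤-trans; ≤∧≢⇒<; ≤-pred; *-cancelʳ-≤; module ≤-Reasoning)
  renaming (_≟_ to _≟ℕ_)
open import Data.Nat.Solver using (module +-*-Solver)
open import Data.Bool using (true; false)
open import Data.Fin as Fin using (Fin; toℕ; join; splitAt)
open import Data.Fin.Properties using (injective⇒≤; splitAt-join; suc-injective; toℕ<n; toℕ-injective)
  renaming (_≟_ to _≟ᶠ_)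
open import Data.Fin.Subset using (Subset; ∣_∣) renaming (_∈_ to _∈ₛ_)
open import Data.Vec.Base using ([]; _∷_; here; there)
open import Data.Fin.Subset.Properties using (_∈?_)
open import Data.Product using (_×_; _,_; proj₁; proj₂)
open import Data.Sum as Sum using (_⊎_; inj₁; inj₂)
open import Data.Empty using (⊥; ⊥-elim)
open import Data.List using (List; []; _∷_; _++_; map; length; filter; concatMap; allFin; lookup)
open import Data.List.Properties using (length-map; length-++; length-tabulate)
open import Data.List.Relation.Unary.All as All using (All; []; _∷_)
open import Data.List.Relation.Unary.All.Properties as All using (all-filter)
open import Data.List.Relation.Unary.Any as Any using (Any; any?)
open import Data.List.Relation.Unary.AllPairs as AllPairs using (AllPairs; []; _∷_)
import Data.List.Relation.Unary.AllPairs.Properties as AllPairs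
open import Data.List.Relation.Unary.Unique.Propositional using (Unique)
import Data.List.Relation.Unary.Unique.Propositional.Properties as Unique
open import Data.List.Relation.Binary.Disjoint.Propositional using (Disjoint)
open import Data.List.Relation.Binary.Sublist.Propositional.Properties
  using (filter-⊆; length-mono-≤) renaming (filter⁺ to filter-mono)
open import Data.List.Membership.Propositional using (_∈_; find; lose)
open import Data.List.Membership.Propositional.Properties using (∈-lookup; ∈-map⁻; ∈-AllPairs₂)
open import Function using (_∘_; id)
open import Relation.Binary.Core using (Rel)
open import Relation.Binary.Definitions using (tri<; tri≈; tri>)
open import Relation.Binary.PropositionalEquality
  using (_≡_; _≢_; refl; sym; trans; cong; cong₂; subst; subst₂; module ≡-Reasoning)
open import Relation.Binary.Structures using (IsStrictTotalOrder)
open import Relation.Nullary using (¬_; Dec; does; yes; no; ¬?)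
open import Relation.Nullary.Decidable using (_×-dec_)
open import Relation.Unary using (Pred; Decidable)
open import Relation.Unary.Properties using (∁?)

private
  variable
    A : Set
    n : ℕ

lookup-injective : {xs : List A} → Unique xs → ∀ {i j} → lookup xs i ≡ lookup xs j → i ≡ j
lookup-injective {xs = _ ∷ _} (_  ∷ _)   {Fin.zero}  {Fin.zero}  _  = refl
lookup-injective {xs = _ ∷ _} (x∉ ∷ _)   {Fin.zero}  {Fin.suc j} eq = ⊥-elim (All.lookup x∉ (∈-lookup j) eq)
lookup-injective {xs = _ ∷ _} (x∉ ∷ _)   {Fin.suc i} {Fin.zero}  eq = ⊥-elim (All.lookup x∉ (∈-lookup i) (sym eq))
lookup-injective {xs = _ ∷ _} (_  ∷ u)   {Fin.suc i} {Fin.suc j} eq = cong Fin.suc (lookup-injective u eq)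

Unique∧injective⇒length≤ : {xs : List A} (f : A → Fin n) → Unique xs →
  (∀ {x y} → x ∈ xs → y ∈ xs → f x ≡ f y → x ≡ y) → length xs ≤ n
Unique∧injective⇒length≤ f u f-inj =
  injective⇒≤ (lookup-injective u ∘ f-inj (∈-lookup _) (∈-lookup _))

join-injective : ∀ m n {x y : Fin m ⊎ Fin n} → join m n x ≡ join m n y → x ≡ y
join-injective m n {x} {y} eq = begin
  x                          ≡⟨ sym (splitAt-join m n x) ⟩
  splitAt m (join m n x)     ≡⟨ cong (splitAt m) eq ⟩
  splitAt m (join m n y)     ≡⟨ splitAt-join m n y ⟩
  y                          ∎
  where open ≡-Reasoning

length-filter+length-filter∁ : {P : Pred A 0ℓ} (P? : Decidable P) (xs : List A) →
  length (filter P? xs) + length (filter (∁? P?) xs) ≡ length xs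
length-filter+length-filter∁ P? [] = refl
length-filter+length-filter∁ P? (x ∷ xs) with does (P? x)
... | true  = cong suc (length-filter+length-filter∁ P? xs)
... | false = trans (+-suc _ _) (cong suc (length-filter+length-filter∁ P? xs))

All⇒AllPairs : {P : Pred A 0ℓ} {R : Rel A 0ℓ} → (∀ {x y} → P x → P y → R x y) →
  {xs : List A} → All P xs → AllPairs R xs
All⇒AllPairs r []         = []
All⇒AllPairs r (px ∷ pxs) = All.map (r px) pxs ∷ All⇒AllPairs r pxs

module _ (colour : A → ℕ) where

  colourClass : ℕ → List A → List A
  colourClass i = filter (λ x → colour x ≟ℕ i)

  length≤*-if-colourClasses≤ : ∀ m {B} (xs : List A) → All (λ x → colour x < m) xs →
    (∀ i → length (colourClass i xs) ≤ B) → length xs ≤ m * B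
  length≤*-if-colourClasses≤ zero    []      _        _          = z≤n
  length≤*-if-colourClasses≤ zero    (_ ∷ _) (() ∷ _) _
  length≤*-if-colourClasses≤ (suc m) {B} xs colour<1+m classes≤B = begin
    length xs                                 ≡⟨ sym (length-filter+length-filter∁ _ xs) ⟩
    length (colourClass m xs) + length others ≤⟨ +-mono-≤ (classes≤B m) others≤m*B ⟩
    B + m * B                                 ∎
    where
    open ≤-Reasoning
    others : List A
    others = filter (∁? λ x → colour x ≟ℕ m) xs

    colour<m : All (λ x → colour x < m) others
    colour<m = All.zipWith (λ (<1+m , ≢m) → ≤∧≢⇒< (≤-pred <1+m) ≢m)
                           (All.filter⁺ _ colour<1+m , all-filter _ xs)

    others≤m*B : length others ≤ m * B
    others≤m*B = length≤*-if-colourClasses≤ m others colour<m λ i →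
      ≤-trans (length-mono-≤ (filter-mono _ _ (λ { refl → id }) (filter-⊆ _ xs))) (classes≤B i)

elements : Subset n → List (Fin n)
elements []          = []
elements (true  ∷ s) = Fin.zero ∷ map Fin.suc (elements s)
elements (false ∷ s) = map Fin.suc (elements s)

length-elements : (s : Subset n) → length (elements s) ≡ ∣ s ∣
length-elements []          = refl
length-elements (true  ∷ s) = cong suc (trans (length-map Fin.suc (elements s)) (length-elements s))
length-elements (false ∷ s) = trans (length-map Fin.suc (elements s)) (length-elements s)

∈-elements⁻ : (s : Subset n) {x : Fin n} → x ∈ elements s → x ∈ₛ s
∈-elements⁻ (true  ∷ s) (Any.here refl) = here
∈-elements⁻ (true  ∷ s) (Any.there x∈)  with ∈-map⁻ Fin.suc x∈
... | _ , y∈ , refl = there (∈-elements⁻ s y∈)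
∈-elements⁻ (false ∷ s) x∈ with ∈-map⁻ Fin.suc x∈
... | _ , y∈ , refl = there (∈-elements⁻ s y∈)

elements-unique : (s : Subset n) → Unique (elements s)
elements-unique []          = []
elements-unique (true  ∷ s) =
  All.map⁺ (All.universal (λ _ ()) (elements s)) ∷ Unique.map⁺ suc-injective (elements-unique s)
elements-unique (false ∷ s) = Unique.map⁺ suc-injective (elements-unique s)

module _ {k : ℕ} (P : AffinePlane k) where
  open AffinePlane P

  line-unique : ∀ {p q L M} → p ≢ q → p ∈ₛ line L → q ∈ₛ line L → p ∈ₛ line M → q ∈ₛ line M → L ≡ M
  line-unique {p} {q} {L} {M} p≢q p∈L q∈L p∈M q∈M with unique-line p q p≢q
  ... | _ , _ , through-p-q⇒≡ = trans (through-p-q⇒≡ L p∈L q∈L) (sym (through-p-q⇒≡ M p∈M q∈M))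

module _ {k : ℕ} (P : AffinePlane k) (_≺_ : Rel (Point k) 0ℓ) (≺-isSTO : IsStrictTotalOrder _≡_ _≺_) where
  open AffinePlane P
  open Graph P _≺_
  open IsStrictTotalOrder ≺-isSTO using (compare; irrefl) renaming (trans to ≺-trans)

  ≺⇒≢ : ∀ {p q} → p ≺ q → p ≢ q
  ≺⇒≢ p≺q p≡q = irrefl p≡q p≺q

  ¬transitive-triangle : ∀ {u v w} → IsVertex v → Arc u v → Arc v w → Arc u w → ⊥
  ¬transitive-triangle q∈L (p≺q , _ , p∈L) (_ , L≢M , q∈M) (_ , _ , p∈M) =
    L≢M (line-unique P (≺⇒≢ p≺q) p∈L q∈L p∈M q∈M)

  ¬cyclic-triangle : ∀ {u v w} → Arc u v → Arc v w → Arc w u → ⊥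
  ¬cyclic-triangle (p≺q , _) (q≺r , _) (r≺p , _) = irrefl refl (≺-trans (≺-trans p≺q q≺r) r≺p)

  triangleFree : TriangleFree
  triangleFree _ _ _ _  iv _  (inj₁ uv , inj₁ vw , inj₁ uw) = ¬transitive-triangle iv uv vw uw
  triangleFree _ _ _ _  _  _  (inj₁ uv , inj₁ vw , inj₂ wu) = ¬cyclic-triangle uv vw wu
  triangleFree _ _ _ _  _  iw (inj₁ uv , inj₂ wv , inj₁ uw) = ¬transitive-triangle iw uw wv uv
  triangleFree _ _ _ iu _  _  (inj₁ uv , inj₂ wv , inj₂ wu) = ¬transitive-triangle iu wu uv wv
  triangleFree _ _ _ iu _  _  (inj₂ vu , inj₁ vw , inj₁ uw) = ¬transitive-triangle iu vu uw vw
  triangleFree _ _ _ _  _  iw (inj₂ vu , inj₁ vw , inj₂ wu) = ¬transitive-triangle iw vw wu vu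
  triangleFree _ _ _ _  _  _  (inj₂ vu , inj₂ wv , inj₁ uw) = ¬cyclic-triangle uw wv vu
  triangleFree _ _ _ _  iv _  (inj₂ vu , inj₂ wv , inj₂ wu) = ¬transitive-triangle iv wv vu wu

  Adj-irrefl : ∀ {u} → ¬ Adj u u
  Adj-irrefl (inj₁ (_ , L≢L , _)) = L≢L refl
  Adj-irrefl (inj₂ (_ , L≢L , _)) = L≢L refl

  PointRepeated : List Pair → Pair → Set
  PointRepeated xs (p , L) = Any (λ (p′ , L′) → p′ ≡ p × L′ ≢ L) xs

  pointRepeated? : ∀ xs u → Dec (PointRepeated xs u)
  pointRepeated? xs (p , L) = any? (λ (p′ , L′) → (p′ ≟ᶠ p) ×-dec ¬? (L′ ≟ᶠ L)) xs

  module _ {xs : List Pair} (xs-independent : Independent xs) where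
    private
      xs-vertices : All IsVertex xs
      xs-vertices = proj₁ (proj₂ xs-independent)

    ¬Adj-∈ : ∀ {u v} → u ∈ xs → v ∈ xs → ¬ Adj u v
    ¬Adj-∈ u∈ v∈ with ∈-AllPairs₂ (proj₂ (proj₂ xs-independent)) u∈ v∈
    ... | inj₁ refl        = Adj-irrefl
    ... | inj₂ (inj₁ ¬uv) = ¬uv
    ... | inj₂ (inj₂ ¬vu) = ¬vu ∘ Sum.swap

    pointRepeated⇒≺-maximal : ∀ {p q L} → PointRepeated xs (p , L) → (p , L) ∈ xs → (q , L) ∈ xs → ¬ (p ≺ q)
    pointRepeated⇒≺-maximal repeated pL∈ qL∈ p≺q with find repeated
    ... | _ , pL′∈ , refl , L′≢L = ¬Adj-∈ pL′∈ qL∈ (inj₁ (p≺q , L′≢L , All.lookup xs-vertices pL∈))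

    pointOrLine : Pair → Point k ⊎ Line k
    pointOrLine u@(p , L) with pointRepeated? xs u
    ... | yes _ = inj₂ L
    ... | no  _ = inj₁ p

    pointOrLine-injective : ∀ {u v} → u ∈ xs → v ∈ xs → pointOrLine u ≡ pointOrLine v → u ≡ v
    pointOrLine-injective {p , L} {q , M} u∈ v∈ eq
      with pointRepeated? xs (p , L) | pointRepeated? xs (q , M) | eq
    ... | yes u-rep | yes v-rep | refl with compare p q
    ...   | tri< p≺q _ _ = ⊥-elim (pointRepeated⇒≺-maximal u-rep u∈ v∈ p≺q)
    ...   | tri≈ _ refl _ = refl
    ...   | tri> _ _ q≺p = ⊥-elim (pointRepeated⇒≺-maximal v-rep v∈ u∈ q≺p)
    pointOrLine-injective {p , L} {q , M} u∈ v∈ eq | no ¬u-rep | no _ | refl with L ≟ᶠ M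
    ... | yes refl = refl
    ... | no  L≢M  = ⊥-elim (¬u-rep (lose v∈ (refl , L≢M ∘ sym)))

  independenceNumber≤ : IndependenceNumber≤ (2 * (k * k) + k)
  independenceNumber≤ xs xs-independent = begin
    length xs            ≤⟨ Unique∧injective⇒length≤ (join _ _ ∘ pointOrLine xs-independent)
                              (proj₁ xs-independent)
                              (λ u∈ v∈ → pointOrLine-injective xs-independent u∈ v∈ ∘ join-injective _ _) ⟩
    k * k + (k * k + k)  ≡⟨ solve 1 (λ k → k :* k :+ (k :* k :+ k) := con 2 :* (k :* k) :+ k) refl k ⟩
    2 * (k * k) + k      ∎
    where
    open ≤-Reasoning
    open +-*-Solver

  flagsOn : Line k → List Pair
  flagsOn L = map (_, L) (elements (line L))

  flags : List (Line k) → List Pair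
  flags = concatMap flagsOn

  length-flags : ∀ Ls → length (flags Ls) ≡ length Ls * k
  length-flags []       = refl
  length-flags (L ∷ Ls) = begin
    length (flagsOn L ++ flags Ls)          ≡⟨ length-++ (flagsOn L) ⟩
    length (flagsOn L) + length (flags Ls)  ≡⟨ cong₂ _+_ length-flagsOn (length-flags Ls) ⟩
    k + length Ls * k                       ∎
    where
    open ≡-Reasoning
    length-flagsOn : length (flagsOn L) ≡ k
    length-flagsOn = trans (length-map _ (elements (line L))) (trans (length-elements (line L)) (lineSize L))

  flags-vertices : ∀ Ls → All IsVertex (flags Ls)
  flags-vertices Ls = All.concat⁺ (All.map⁺ (All.universal flagsOn-vertices Ls))
    where
    flagsOn-vertices : ∀ L → All IsVertex (flagsOn L)
    flagsOn-vertices L = All.map⁺ (All.tabulate (∈-elements⁻ (line L)))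

  flags-unique : ∀ {Ls} → Unique Ls → Unique (flags Ls)
  flags-unique {Ls} Ls-unique = Unique.concat⁺
    (All.map⁺ (All.universal (λ L → Unique.map⁺ (cong proj₁) (elements-unique (line L))) Ls))
    (AllPairs.map⁺ (AllPairs.map flagsOn-disjoint Ls-unique))
    where
    flagsOn-disjoint : ∀ {L M} → L ≢ M → Disjoint (flagsOn L) (flagsOn M)
    flagsOn-disjoint L≢M (v∈L , v∈M) with ∈-map⁻ _ v∈L | ∈-map⁻ _ v∈M
    ... | _ , _ , refl | _ , _ , refl = L≢M refl

  allFlags : List Pair
  allFlags = flags (allFin (k * k + k))

  allFlags-vertices : All IsVertex allFlags
  allFlags-vertices = flags-vertices (allFin (k * k + k))

  length-allFlags : length allFlags ≡ (k * k + k) * k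
  length-allFlags =
    trans (length-flags (allFin (k * k + k))) (cong (_* k) (length-tabulate (id {A = Line k})))

  module _ {m : ℕ} (c : (u : Pair) → IsVertex u → Fin m)
           (proper : ∀ u v (iu : IsVertex u) (iv : IsVertex v) → Adj u v → c u iu ≢ c v iv) where

    colour : Pair → ℕ
    colour (p , L) with p ∈? line L
    ... | yes iu = toℕ (c (p , L) iu)
    ... | no  _  = m   -- junk: only vertices are ever coloured

    colour<m : ∀ {u} → IsVertex u → colour u < m
    colour<m {p , L} iu with p ∈? line L
    ... | yes iu′ = toℕ<n (c (p , L) iu′)
    ... | no ¬iu  = ⊥-elim (¬iu iu)

    sameColour⇒¬Adj : ∀ {u v} → IsVertex u → IsVertex v → colour u ≡ colour v → ¬ Adj u v
    sameColour⇒¬Adj {p , L} {q , M} iu iv eq with p ∈? line L | q ∈? line M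
    ... | yes iu′ | yes iv′ = λ adj → proper _ _ iu′ iv′ adj (toℕ-injective eq)
    ... | no ¬iu  | _       = ⊥-elim (¬iu iu)
    ... | _       | no ¬iv  = ⊥-elim (¬iv iv)

    colourClass-independent : ∀ i → Independent (colourClass colour i allFlags)
    colourClass-independent i =
      Unique.filter⁺ _ (flags-unique (Unique.allFin⁺ (k * k + k))) ,
      All.filter⁺ _ allFlags-vertices ,
      All⇒AllPairs (λ (iu , u≡i) (iv , v≡i) → sameColour⇒¬Adj iu iv (trans u≡i (sym v≡i)))
                   (All.zip (All.filter⁺ _ allFlags-vertices , all-filter _ allFlags))

    length-allFlags≤ : length allFlags ≤ m * (2 * (k * k) + k)
    length-allFlags≤ = length≤*-if-colourClasses≤ colour m allFlags
      (All.map colour<m allFlags-vertices)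
      (λ i → independenceNumber≤ _ (colourClass-independent i))

  chromaticNumber≥ : ∀ m → ProperColouring m → k * (k + 1) ≤ m * (2 * k + 1)
  chromaticNumber≥ m (c , proper) =
    cancel-factor k (subst (_≤ _) length-allFlags (length-allFlags≤ c proper))
    where
    open +-*-Solver
    cancel-factor : ∀ n → (n * n + n) * n ≤ m * (2 * (n * n) + n) → n * (n + 1) ≤ m * (2 * n + 1)
    cancel-factor zero      _ = z≤n
    cancel-factor n@(suc _) h = *-cancelʳ-≤ _ _ n (subst₂ _≤_
      (solve 1 (λ n → (n :* n :+ n) :* n := n :* (n :+ con 1) :* n) refl n)
      (solve 2 (λ m n → m :* (con 2 :* (n :* n) :+ n) := m :* (con 2 :* n :+ con 1) :* n) refl m n)
      h)

theorem3p3 : (k : ℕ) → IsPrimePower k → (P : AffinePlane k) →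
    (_≺_ : Rel (Point k) 0ℓ) → IsStrictTotalOrder _≡_ _≺_ →
    Graph.TriangleFree P _≺_ ×
    Graph.IndependenceNumber≤ P _≺_ (2 * (k * k) + k) ×
    (∀ m → Graph.ProperColouring P _≺_ m → k * (k + 1) ≤ m * (2 * k + 1))
-- The prime-power hypothesis only ensures that a plane of order k exists.
theorem3p3 k _ P _≺_ ≺-isSTO =
  triangleFree P _≺_ ≺-isSTO , independenceNumber≤ P _≺_ ≺-isSTO , chromaticNumber≥ P _≺_ ≺-isSTO
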